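{- Let $(\mathcal{C},\otimes,I)$ be a symmetric monoidal category and consider the oplax monoidal functor $\mathrm{List}^+\colon\mathcal{C}^{\mathbb{N}}\to\mathcal{C}^{\mathbb{N}}$. Then $\mathrm{List}^+$ (with this oplax monoidal structure) admits the structure of an oplax monoidal comonad if and only if $\mathcal{C}$ is cartesian monoidal.
   Context: $\mathcal{C}^{\mathbb{N}}$ is the monoidal category of sequences $\mathbf{X}=(X_0,X_1,\dots)$ of objects of $\mathcal{C}$, with componentwise morphisms and tensor, unit the constant sequence $(I,I,\dots)$. $\mathrm{List}^+$ is defined by $\mathrm{List}^+(\mathbf{X})_n=\bigotimes_{i=0}^n X_i$ and $\mathrm{List}^+(\mathbf{f})_n=f_0\otimes\dots\otimes f_n$; it is oplax monoidal with structure maps $\psi_0\colon\mathrm{List}^+(\mathbf{I})\to\mathbf{I}$ and $\psi_{\mathbf{X},\mathbf{Y}}\colon\mathrm{List}^+(\mathbf{X}\otimes\mathbf{Y})\to\mathrm{List}^+(\mathbf{X})\otimes\mathrm{List}^+(\mathbf{Y})$ given componentwise by symmetries, associators and unitors. An oplax monoidal comonad on a monoidal category is a comonad $(R,\varepsilon,\delta)$ whose underlying endofunctor $R$ is oplax monoidal (with given structure maps) and whose counit $\varepsilon\colon R\Rightarrow\mathrm{Id}$ and comultiplication $\delta\colon R\Rightarrow RR$ are monoidal natural transformations (with respect to the identity oplax structure on $\mathrm{Id}$ and the composite oplax structure on $RR$). Cartesian monoidal: the tensor is the categorical product and the unit is terminal. -}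

module Defs where

open import Level using (Level; _⊔_) renaming (suc to lsuc)
open import Data.Nat using (ℕ; zero; suc)
open import Relation.Binary using (Rel; IsEquivalence)

record Category (o ℓ e : Level) : Set (lsuc (o ⊔ ℓ ⊔ e)) where
  infix  4 _≈_
  infix  5 _⇒_
  infixr 9 _∘_
  field
    Obj : Set o
    _⇒_ : Obj → Obj → Set ℓ
    _≈_ : ∀ {A B} → Rel (A ⇒ B) e
    id  : ∀ {A} → A ⇒ A
    _∘_ : ∀ {A B C} → B ⇒ C → A ⇒ B → A ⇒ C
    equiv     : ∀ {A B} → IsEquivalence (_≈_ {A} {B})
    assoc     : ∀ {A B C D} {f : A ⇒ B} {g : B ⇒ C} {h : C ⇒ D} →
                (h ∘ g) ∘ f ≈ h ∘ (g ∘ f)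
    identityˡ : ∀ {A B} {f : A ⇒ B} → id ∘ f ≈ f
    identityʳ : ∀ {A B} {f : A ⇒ B} → f ∘ id ≈ f
    ∘-resp-≈  : ∀ {A B C} {f h : B ⇒ C} {g i : A ⇒ B} →
                f ≈ h → g ≈ i → f ∘ g ≈ h ∘ i

record Endofunctor {o ℓ e} (D : Category o ℓ e) : Set (o ⊔ ℓ ⊔ e) where
  open Category D
  field
    F₀ : Obj → Obj
    F₁ : ∀ {A B} → A ⇒ B → F₀ A ⇒ F₀ B
    identity     : ∀ {A} → F₁ (id {A}) ≈ id
    homomorphism : ∀ {A B C} {f : A ⇒ B} {g : B ⇒ C} →
                   F₁ (g ∘ f) ≈ F₁ g ∘ F₁ f
    F-resp-≈     : ∀ {A B} {f g : A ⇒ B} → f ≈ g → F₁ f ≈ F₁ g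

record Monoidal {o ℓ e} (C : Category o ℓ e) : Set (o ⊔ ℓ ⊔ e) where
  open Category C
  infixr 10 _⊗₀_ _⊗₁_
  field
    _⊗₀_ : Obj → Obj → Obj
    _⊗₁_ : ∀ {A B X Y} → A ⇒ B → X ⇒ Y → (A ⊗₀ X) ⇒ (B ⊗₀ Y)
    unit : Obj
    ⊗-identity     : ∀ {A B} → id {A} ⊗₁ id {B} ≈ id
    ⊗-homomorphism : ∀ {A B C X Y Z} {f₁ : A ⇒ B} {g₁ : B ⇒ C}
                       {f₂ : X ⇒ Y} {g₂ : Y ⇒ Z} →
                     (g₁ ∘ f₁) ⊗₁ (g₂ ∘ f₂) ≈ (g₁ ⊗₁ g₂) ∘ (f₁ ⊗₁ f₂)
    ⊗-resp-≈       : ∀ {A B X Y} {f f' : A ⇒ B} {g g' : X ⇒ Y} →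
                     f ≈ f' → g ≈ g' → f ⊗₁ g ≈ f' ⊗₁ g'
    λ⇒ : ∀ {A} → unit ⊗₀ A ⇒ A
    λ⇐ : ∀ {A} → A ⇒ unit ⊗₀ A
    ρ⇒ : ∀ {A} → A ⊗₀ unit ⇒ A
    ρ⇐ : ∀ {A} → A ⇒ A ⊗₀ unit
    α⇒ : ∀ {A B C} → (A ⊗₀ B) ⊗₀ C ⇒ A ⊗₀ (B ⊗₀ C)
    α⇐ : ∀ {A B C} → A ⊗₀ (B ⊗₀ C) ⇒ (A ⊗₀ B) ⊗₀ C
    λ-isoˡ : ∀ {A} → λ⇐ ∘ λ⇒ ≈ id {unit ⊗₀ A}
    λ-isoʳ : ∀ {A} → λ⇒ ∘ λ⇐ ≈ id {A}
    ρ-isoˡ : ∀ {A} → ρ⇐ ∘ ρ⇒ ≈ id {A ⊗₀ unit}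
    ρ-isoʳ : ∀ {A} → ρ⇒ ∘ ρ⇐ ≈ id {A}
    α-isoˡ : ∀ {A B C} → α⇐ ∘ α⇒ ≈ id {(A ⊗₀ B) ⊗₀ C}
    α-isoʳ : ∀ {A B C} → α⇒ ∘ α⇐ ≈ id {A ⊗₀ (B ⊗₀ C)}
    λ-natural : ∀ {A B} {f : A ⇒ B} → λ⇒ ∘ (id ⊗₁ f) ≈ f ∘ λ⇒
    ρ-natural : ∀ {A B} {f : A ⇒ B} → ρ⇒ ∘ (f ⊗₁ id) ≈ f ∘ ρ⇒
    α-natural : ∀ {A B C X Y Z} {f : A ⇒ X} {g : B ⇒ Y} {h : C ⇒ Z} →
                α⇒ ∘ ((f ⊗₁ g) ⊗₁ h) ≈ (f ⊗₁ (g ⊗₁ h)) ∘ α⇒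
    triangle : ∀ {A B} → (id {A} ⊗₁ λ⇒ {B}) ∘ α⇒ ≈ ρ⇒ ⊗₁ id
    pentagon : ∀ {A B C D} →
               (id {A} ⊗₁ α⇒ {B} {C} {D}) ∘ α⇒ ∘ (α⇒ ⊗₁ id) ≈ α⇒ ∘ α⇒

record Symmetric {o ℓ e} {C : Category o ℓ e} (M : Monoidal C)
       : Set (o ⊔ ℓ ⊔ e) where
  open Category C
  open Monoidal M
  field
    σ : ∀ {A B} → A ⊗₀ B ⇒ B ⊗₀ A
    σ-natural   : ∀ {A B X Y} {f : A ⇒ X} {g : B ⇒ Y} →
                  σ ∘ (f ⊗₁ g) ≈ (g ⊗₁ f) ∘ σ
    commutative : ∀ {A B} → σ {B} {A} ∘ σ {A} {B} ≈ id
    hexagon     : ∀ {A B C} →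
                  α⇒ ∘ σ {A} {B ⊗₀ C} ∘ α⇒ ≈ (id ⊗₁ σ) ∘ α⇒ ∘ (σ ⊗₁ id)

record SymmetricMonoidalCategory (o ℓ e : Level) : Set (lsuc (o ⊔ ℓ ⊔ e)) where
  field
    U         : Category o ℓ e
    monoidal  : Monoidal U
    symmetric : Symmetric monoidal
  open Category U public
  open Monoidal monoidal public
  open Symmetric symmetric public

-- Cartesian monoidal: the unit is terminal and the tensor, with the
-- canonical projections  ρ ∘ (id ⊗ !)  and  λ ∘ (! ⊗ id),  is a product.

record IsCartesianMonoidal {o ℓ e} (𝒞 : SymmetricMonoidalCategory o ℓ e)
       : Set (o ⊔ ℓ ⊔ e) where
  open SymmetricMonoidalCategory 𝒞
  field
    !        : ∀ {A} → A ⇒ unit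
    !-unique : ∀ {A} (f : A ⇒ unit) → f ≈ !
    ⟨_,_⟩    : ∀ {Z A B} → Z ⇒ A → Z ⇒ B → Z ⇒ A ⊗₀ B
    project₁ : ∀ {Z A B} {f : Z ⇒ A} {g : Z ⇒ B} →
               (ρ⇒ ∘ (id ⊗₁ !)) ∘ ⟨ f , g ⟩ ≈ f
    project₂ : ∀ {Z A B} {f : Z ⇒ A} {g : Z ⇒ B} →
               (λ⇒ ∘ (! ⊗₁ id)) ∘ ⟨ f , g ⟩ ≈ g
    unique   : ∀ {Z A B} {f : Z ⇒ A} {g : Z ⇒ B} (h : Z ⇒ A ⊗₀ B) →
               (ρ⇒ ∘ (id ⊗₁ !)) ∘ h ≈ f → (λ⇒ ∘ (! ⊗₁ id)) ∘ h ≈ g →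
               h ≈ ⟨ f , g ⟩

record OplaxMonoidalComonad {o ℓ e} {D : Category o ℓ e} (M : Monoidal D)
       (F : Endofunctor D)
       (ψ₀ : Category._⇒_ D (Endofunctor.F₀ F (Monoidal.unit M)) (Monoidal.unit M))
       (ψ  : ∀ X Y → Category._⇒_ D (Endofunctor.F₀ F (Monoidal._⊗₀_ M X Y))
                        (Monoidal._⊗₀_ M (Endofunctor.F₀ F X) (Endofunctor.F₀ F Y)))
       : Set (o ⊔ ℓ ⊔ e) where
  open Category D
  open Monoidal M
  open Endofunctor F
  field
    ε : ∀ X → F₀ X ⇒ X
    δ : ∀ X → F₀ X ⇒ F₀ (F₀ X)
    ε-natural : ∀ {X Y} (f : X ⇒ Y) → ε Y ∘ F₁ f ≈ f ∘ ε X
    δ-natural : ∀ {X Y} (f : X ⇒ Y) → δ Y ∘ F₁ f ≈ F₁ (F₁ f) ∘ δ X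
    counitˡ : ∀ X → F₁ (ε X) ∘ δ X ≈ id
    counitʳ : ∀ X → ε (F₀ X) ∘ δ X ≈ id
    coassoc : ∀ X → F₁ (δ X) ∘ δ X ≈ δ (F₀ X) ∘ δ X
    -- ε is monoidal (Id carries the identity oplax structure)
    ε-monoidal-unit : id ∘ ε unit ≈ ψ₀
    ε-monoidal-⊗    : ∀ X Y → id ∘ ε (X ⊗₀ Y) ≈ (ε X ⊗₁ ε Y) ∘ ψ X Y
    -- δ is monoidal (FF carries the composite oplax structure)
    δ-monoidal-unit : (ψ₀ ∘ F₁ ψ₀) ∘ δ unit ≈ ψ₀
    δ-monoidal-⊗    : ∀ X Y → (ψ (F₀ X) (F₀ Y) ∘ F₁ (ψ X Y)) ∘ δ (X ⊗₀ Y)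
                              ≈ (δ X ⊗₁ δ Y) ∘ ψ X Y

module Sequences {o ℓ e} (𝒞 : SymmetricMonoidalCategory o ℓ e) where
  open SymmetricMonoidalCategory 𝒞
  module E {A B} = IsEquivalence (equiv {A} {B})

  Seq : Category o ℓ e
  Seq = record
    { Obj = ℕ → Obj
    ; _⇒_ = λ X Y → ∀ n → X n ⇒ Y n
    ; _≈_ = λ f g → ∀ n → f n ≈ g n
    ; id  = λ n → id
    ; _∘_ = λ g f n → g n ∘ f n
    ; equiv = record { refl = λ n → E.refl
                     ; sym = λ p n → E.sym (p n)
                     ; trans = λ p q n → E.trans (p n) (q n) }
    ; assoc = λ n → assoc
    ; identityˡ = λ n → identityˡ
    ; identityʳ = λ n → identityʳ
    ; ∘-resp-≈ = λ p q n → ∘-resp-≈ (p n) (q n)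
    }

  SeqMonoidal : Monoidal Seq
  SeqMonoidal = record
    { _⊗₀_ = λ X Y n → X n ⊗₀ Y n
    ; _⊗₁_ = λ f g n → f n ⊗₁ g n
    ; unit = λ _ → unit
    ; ⊗-identity = λ n → ⊗-identity
    ; ⊗-homomorphism = λ n → ⊗-homomorphism
    ; ⊗-resp-≈ = λ p q n → ⊗-resp-≈ (p n) (q n)
    ; λ⇒ = λ n → λ⇒ ; λ⇐ = λ n → λ⇐
    ; ρ⇒ = λ n → ρ⇒ ; ρ⇐ = λ n → ρ⇐
    ; α⇒ = λ n → α⇒ ; α⇐ = λ n → α⇐
    ; λ-isoˡ = λ n → λ-isoˡ ; λ-isoʳ = λ n → λ-isoʳ
    ; ρ-isoˡ = λ n → ρ-isoˡ ; ρ-isoʳ = λ n → ρ-isoʳ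
    ; α-isoˡ = λ n → α-isoˡ ; α-isoʳ = λ n → α-isoʳ
    ; λ-natural = λ n → λ-natural
    ; ρ-natural = λ n → ρ-natural
    ; α-natural = λ n → α-natural
    ; triangle = λ n → triangle
    ; pentagon = λ n → pentagon
    }

  List⁺₀ : (ℕ → Obj) → ℕ → Obj
  List⁺₀ X zero    = X zero
  List⁺₀ X (suc n) = List⁺₀ X n ⊗₀ X (suc n)

  List⁺₁ : ∀ {X Y : ℕ → Obj} → (∀ n → X n ⇒ Y n) →
           ∀ n → List⁺₀ X n ⇒ List⁺₀ Y n
  List⁺₁ f zero    = f zero
  List⁺₁ f (suc n) = List⁺₁ f n ⊗₁ f (suc n)

  private
    L-identity : ∀ {X : ℕ → Obj} n → List⁺₁ {X} {X} (λ m → id) n ≈ id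
    L-identity zero    = E.refl
    L-identity {X} (suc n) =
      E.trans (⊗-resp-≈ (L-identity {X} n) E.refl) ⊗-identity

    L-hom : ∀ {X Y Z : ℕ → Obj} {f : ∀ n → X n ⇒ Y n} {g : ∀ n → Y n ⇒ Z n} n →
            List⁺₁ {X} {Z} (λ m → g m ∘ f m) n ≈ List⁺₁ g n ∘ List⁺₁ f n
    L-hom zero    = E.refl
    L-hom {X} {Y} {Z} {f} {g} (suc n) =
      E.trans (⊗-resp-≈ (L-hom {X} {Y} {Z} {f} {g} n) E.refl) ⊗-homomorphism

    L-resp : ∀ {X Y : ℕ → Obj} {f g : ∀ n → X n ⇒ Y n} → (∀ n → f n ≈ g n) →
             ∀ n → List⁺₁ f n ≈ List⁺₁ g n
    L-resp p zero    = p zero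
    L-resp {X} {Y} {f} {g} p (suc n) =
      ⊗-resp-≈ (L-resp {X} {Y} {f} {g} p n) (p (suc n))

  List⁺ : Endofunctor Seq
  List⁺ = record
    { F₀ = List⁺₀
    ; F₁ = List⁺₁
    ; identity = λ {X} → L-identity {X}
    ; homomorphism = λ {X} {Y} {Z} {f} {g} → L-hom {X} {Y} {Z} {f} {g}
    ; F-resp-≈ = λ {X} {Y} {f} {g} → L-resp {X} {Y} {f} {g}
    }

  interchange : ∀ {A B C D} → (A ⊗₀ B) ⊗₀ (C ⊗₀ D) ⇒ (A ⊗₀ C) ⊗₀ (B ⊗₀ D)
  interchange = α⇐ ∘ (id ⊗₁ (α⇒ ∘ (σ ⊗₁ id) ∘ α⇐)) ∘ α⇒

  ψ₀ : ∀ n → List⁺₀ (λ _ → unit) n ⇒ unit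
  ψ₀ zero    = id
  ψ₀ (suc n) = λ⇒ ∘ (ψ₀ n ⊗₁ id)

  ψ : ∀ X Y n → List⁺₀ (λ m → X m ⊗₀ Y m) n ⇒ List⁺₀ X n ⊗₀ List⁺₀ Y n
  ψ X Y zero    = id
  ψ X Y (suc n) = interchange ∘ (ψ X Y n ⊗₁ id)

List⁺-OplaxMonoidalComonad : ∀ {o ℓ e} → SymmetricMonoidalCategory o ℓ e →
                             Set (o ⊔ ℓ ⊔ e)
List⁺-OplaxMonoidalComonad 𝒞 =
  OplaxMonoidalComonad SeqMonoidal List⁺ ψ₀ ψ
  where open Sequences 𝒞

module Submission where

open import Defs
open import Function.Bundles using (_⇔_; mk⇔)
open import Data.Nat using (ℕ; zero; suc)
open import Relation.Binary using (Setoid; IsEquivalence)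
import Relation.Binary.Reasoning.Setoid as SetoidReasoning

-- If 𝒞 is cartesian, List⁺ is a comonad whose counit projects X₀ × ⋯ × Xₙ onto
-- its last factor and whose comultiplication sends it diagonally to all its
-- prefixes; both are monoidal because ψ is the pairing of List⁺ π₁ and List⁺ π₂.
--
-- Conversely, evaluate a comonad structure at the sequence (A, I, I, …).  At
-- index 1 the counit is a map A ⊗ I → I, and naturality together with
-- monoidality of the counit forces it to equal λ ∘ (f ⊗ I) for every f : A → I,
-- so I is terminal.  The comultiplication at index 1, A ⊗ I → A ⊗ (A ⊗ I),
-- yields a natural diagonal A → A ⊗ A: the two counit laws say that it is
-- split by the two projections, and monoidality of the comultiplication says
-- that the diagonal of A ⊗ B is split by π₁ ⊗ π₂, which makes A ⊗ B a product.

module MonoidalLemmas {o ℓ e} (𝒞 : SymmetricMonoidalCategory o ℓ e) where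
  open SymmetricMonoidalCategory 𝒞 public
  open Sequences 𝒞 public using (interchange)

  module Equiv {A B} = IsEquivalence (equiv {A} {B})
  open Equiv public using (refl; sym; trans)

  hom-setoid : Obj → Obj → Setoid ℓ e
  hom-setoid A B = record { Carrier = A ⇒ B ; _≈_ = _≈_ ; isEquivalence = equiv }

  module HomReasoning {A B : Obj} = SetoidReasoning (hom-setoid A B)
  open HomReasoning public using (begin_; _∎; step-≈-⟩; step-≈-⟨)

  infixr 4 _⟩∘⟨_ refl⟩∘⟨_ _⟩⊗⟨_
  infixl 5 _⟩∘⟨refl

  _⟩∘⟨_ : ∀ {A B C} {f h : B ⇒ C} {g i : A ⇒ B} → f ≈ h → g ≈ i → f ∘ g ≈ h ∘ i
  _⟩∘⟨_ = ∘-resp-≈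

  refl⟩∘⟨_ : ∀ {A B C} {f : B ⇒ C} {g i : A ⇒ B} → g ≈ i → f ∘ g ≈ f ∘ i
  refl⟩∘⟨ p = ∘-resp-≈ refl p

  _⟩∘⟨refl : ∀ {A B C} {f h : B ⇒ C} {g : A ⇒ B} → f ≈ h → f ∘ g ≈ h ∘ g
  p ⟩∘⟨refl = ∘-resp-≈ p refl

  _⟩⊗⟨_ : ∀ {A B X Y} {f f' : A ⇒ B} {g g' : X ⇒ Y} →
          f ≈ f' → g ≈ g' → f ⊗₁ g ≈ f' ⊗₁ g'
  _⟩⊗⟨_ = ⊗-resp-≈

  sym-assoc : ∀ {A B C D} {f : A ⇒ B} {g : B ⇒ C} {h : C ⇒ D} →
              h ∘ (g ∘ f) ≈ (h ∘ g) ∘ f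
  sym-assoc = sym assoc

  module _ {A B C D : Obj} {a : C ⇒ D} {b : B ⇒ C} {c : A ⇒ B} where
    pullʳ : ∀ {d : A ⇒ C} → b ∘ c ≈ d → (a ∘ b) ∘ c ≈ a ∘ d
    pullʳ p = trans assoc (refl⟩∘⟨ p)

    pullˡ : ∀ {d : B ⇒ D} → a ∘ b ≈ d → a ∘ (b ∘ c) ≈ d ∘ c
    pullˡ p = trans sym-assoc (p ⟩∘⟨refl)

    pushˡ : ∀ {d : B ⇒ D} → d ≈ a ∘ b → d ∘ c ≈ a ∘ (b ∘ c)
    pushˡ p = sym (pullˡ (sym p))

  elimˡ : ∀ {A B} {a : B ⇒ B} {f : A ⇒ B} → a ≈ id → a ∘ f ≈ f
  elimˡ p = trans (p ⟩∘⟨refl) identityˡ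

  elimʳ : ∀ {A B} {a : A ⇒ A} {f : A ⇒ B} → a ≈ id → f ∘ a ≈ f
  elimʳ p = trans (refl⟩∘⟨ p) identityʳ

  introˡ : ∀ {A B} {a : B ⇒ B} {f : A ⇒ B} → a ≈ id → f ≈ a ∘ f
  introˡ p = sym (elimˡ p)

  introʳ : ∀ {A B} {a : A ⇒ A} {f : A ⇒ B} → a ≈ id → f ≈ f ∘ a
  introʳ p = sym (elimʳ p)

  cancelˡ : ∀ {A B C} {a : C ⇒ B} {b : B ⇒ C} {f : A ⇒ B} → a ∘ b ≈ id → a ∘ (b ∘ f) ≈ f
  cancelˡ p = trans (pullˡ p) identityˡ

  cancelʳ : ∀ {A B C} {a : C ⇒ A} {b : A ⇒ C} {f : A ⇒ B} → a ∘ b ≈ id → (f ∘ a) ∘ b ≈ f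
  cancelʳ p = trans (pullʳ p) identityʳ

  cancelInner : ∀ {A B C D} {a : C ⇒ B} {b : B ⇒ C} {f : B ⇒ D} {g : A ⇒ B} →
                a ∘ b ≈ id → (f ∘ a) ∘ (b ∘ g) ≈ f ∘ g
  cancelInner p = pullʳ (cancelˡ p)

  id-comm : ∀ {A B} {f : A ⇒ B} → id ∘ f ≈ f ∘ id
  id-comm = trans identityˡ (sym identityʳ)

  ⊗∘⊗ : ∀ {A B C X Y Z} {f : B ⇒ C} {h : A ⇒ B} {g : Y ⇒ Z} {k : X ⇒ Y} →
        (f ⊗₁ g) ∘ (h ⊗₁ k) ≈ (f ∘ h) ⊗₁ (g ∘ k)
  ⊗∘⊗ = sym ⊗-homomorphism

  id⊗∘id⊗ : ∀ {A B C X} {f : B ⇒ C} {g : A ⇒ B} →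
            (id {X} ⊗₁ f) ∘ (id ⊗₁ g) ≈ id ⊗₁ (f ∘ g)
  id⊗∘id⊗ = trans ⊗∘⊗ (identityˡ ⟩⊗⟨ refl)

  ⊗id∘⊗id : ∀ {A B C X} {f : B ⇒ C} {g : A ⇒ B} →
            (f ⊗₁ id {X}) ∘ (g ⊗₁ id) ≈ (f ∘ g) ⊗₁ id
  ⊗id∘⊗id = trans ⊗∘⊗ (refl ⟩⊗⟨ identityˡ)

  serialize₁₂ : ∀ {A B X Y} {f : A ⇒ B} {g : X ⇒ Y} → f ⊗₁ g ≈ (f ⊗₁ id) ∘ (id ⊗₁ g)
  serialize₁₂ = trans (sym identityʳ ⟩⊗⟨ sym identityˡ) ⊗-homomorphism

  serialize₂₁ : ∀ {A B X Y} {f : A ⇒ B} {g : X ⇒ Y} → f ⊗₁ g ≈ (id ⊗₁ g) ∘ (f ⊗₁ id)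
  serialize₂₁ = trans (sym identityˡ ⟩⊗⟨ sym identityʳ) ⊗-homomorphism

  ⊗id-iso : ∀ {A B X} {f : A ⇒ B} {g : B ⇒ A} → f ∘ g ≈ id → (f ⊗₁ id {X}) ∘ (g ⊗₁ id) ≈ id
  ⊗id-iso p = trans ⊗id∘⊗id (trans (p ⟩⊗⟨ refl) ⊗-identity)

  id⊗-iso : ∀ {A B X} {f : A ⇒ B} {g : B ⇒ A} → f ∘ g ≈ id → (id {X} ⊗₁ f) ∘ (id ⊗₁ g) ≈ id
  id⊗-iso p = trans id⊗∘id⊗ (trans (refl ⟩⊗⟨ p) ⊗-identity)

  inverse-natural : ∀ {X Y X' Y'} {i : X ⇒ Y} {j : Y ⇒ X} {i' : X' ⇒ Y'} {j' : Y' ⇒ X'}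
                      {f : X ⇒ X'} {g : Y ⇒ Y'} →
                    i ∘ j ≈ id → j' ∘ i' ≈ id → i' ∘ f ≈ g ∘ i → f ∘ j ≈ j' ∘ g
  inverse-natural {i = i} {j} {i'} {j'} {f} {g} ij≈id j'i'≈id natural = begin
    f ∘ j                 ≈⟨ introˡ j'i'≈id ⟩
    (j' ∘ i') ∘ (f ∘ j)   ≈⟨ assoc ⟩
    j' ∘ (i' ∘ (f ∘ j))   ≈⟨ refl⟩∘⟨ pullˡ natural ⟩
    j' ∘ ((g ∘ i) ∘ j)    ≈⟨ refl⟩∘⟨ cancelʳ ij≈id ⟩
    j' ∘ g                ∎

  λ⇐-natural : ∀ {A B} {f : A ⇒ B} → (id ⊗₁ f) ∘ λ⇐ ≈ λ⇐ ∘ f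
  λ⇐-natural = inverse-natural λ-isoʳ λ-isoˡ λ-natural

  ρ⇐-natural : ∀ {A B} {f : A ⇒ B} → (f ⊗₁ id) ∘ ρ⇐ ≈ ρ⇐ ∘ f
  ρ⇐-natural = inverse-natural ρ-isoʳ ρ-isoˡ ρ-natural

  α⇐-natural : ∀ {A B C X Y Z} {f : A ⇒ X} {g : B ⇒ Y} {h : C ⇒ Z} →
               ((f ⊗₁ g) ⊗₁ h) ∘ α⇐ ≈ α⇐ ∘ (f ⊗₁ (g ⊗₁ h))
  α⇐-natural = inverse-natural α-isoʳ α-isoˡ α-natural

  unit⊗-injective : ∀ {A B} {f g : A ⇒ B} → id {unit} ⊗₁ f ≈ id ⊗₁ g → f ≈ g
  unit⊗-injective {f = f} {g} p = begin
    f                     ≈⟨ introʳ λ-isoʳ ⟩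
    f ∘ (λ⇒ ∘ λ⇐)         ≈⟨ pullˡ (sym λ-natural) ⟩
    (λ⇒ ∘ (id ⊗₁ f)) ∘ λ⇐ ≈⟨ (refl⟩∘⟨ p) ⟩∘⟨refl ⟩
    (λ⇒ ∘ (id ⊗₁ g)) ∘ λ⇐ ≈⟨ λ-natural ⟩∘⟨refl ⟩
    (g ∘ λ⇒) ∘ λ⇐         ≈⟨ cancelʳ λ-isoʳ ⟩
    g                     ∎

  ⊗unit-injective : ∀ {A B} {f g : A ⇒ B} → f ⊗₁ id {unit} ≈ g ⊗₁ id → f ≈ g
  ⊗unit-injective {f = f} {g} p = begin
    f                     ≈⟨ introʳ ρ-isoʳ ⟩
    f ∘ (ρ⇒ ∘ ρ⇐)         ≈⟨ pullˡ (sym ρ-natural) ⟩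
    (ρ⇒ ∘ (f ⊗₁ id)) ∘ ρ⇐ ≈⟨ (refl⟩∘⟨ p) ⟩∘⟨refl ⟩
    (ρ⇒ ∘ (g ⊗₁ id)) ∘ ρ⇐ ≈⟨ ρ-natural ⟩∘⟨refl ⟩
    (g ∘ ρ⇒) ∘ ρ⇐         ≈⟨ cancelʳ ρ-isoʳ ⟩
    g                     ∎

  ρ⇒⊗id∘α⇐ : ∀ {A B} → (ρ⇒ {A} ⊗₁ id {B}) ∘ α⇐ ≈ id ⊗₁ λ⇒
  ρ⇒⊗id∘α⇐ = trans (sym triangle ⟩∘⟨refl) (cancelʳ α-isoʳ)

  α⇐∘id⊗α⇒ : ∀ {A B C D} →
             α⇐ ∘ (id {A} ⊗₁ α⇒ {B} {C} {D}) ≈ α⇒ ∘ ((α⇐ ⊗₁ id) ∘ α⇐)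
  α⇐∘id⊗α⇒ = begin
    α⇐ ∘ (id ⊗₁ α⇒)
      ≈⟨ introʳ (trans (pullʳ (cancelˡ (⊗id-iso α-isoʳ))) α-isoʳ) ⟩
    (α⇐ ∘ (id ⊗₁ α⇒)) ∘ ((α⇒ ∘ (α⇒ ⊗₁ id)) ∘ ((α⇐ ⊗₁ id) ∘ α⇐))
      ≈⟨ sym-assoc ⟩
    ((α⇐ ∘ (id ⊗₁ α⇒)) ∘ (α⇒ ∘ (α⇒ ⊗₁ id))) ∘ ((α⇐ ⊗₁ id) ∘ α⇐)
      ≈⟨ pullʳ pentagon ⟩∘⟨refl ⟩
    (α⇐ ∘ (α⇒ ∘ α⇒)) ∘ ((α⇐ ⊗₁ id) ∘ α⇐)
      ≈⟨ cancelˡ α-isoˡ ⟩∘⟨refl ⟩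
    α⇒ ∘ ((α⇐ ⊗₁ id) ∘ α⇐) ∎

  -- Kelly's coherence lemmas, derived from the triangle and pentagon by
  -- cancelling the faithful functors I ⊗ - and - ⊗ I.
  λ⇒∘α⇒ : ∀ {X Y} → λ⇒ {X ⊗₀ Y} ∘ α⇒ {unit} {X} {Y} ≈ λ⇒ ⊗₁ id
  λ⇒∘α⇒ = unit⊗-injective (begin
    id ⊗₁ (λ⇒ ∘ α⇒)                                ≈⟨ sym id⊗∘id⊗ ⟩
    (id ⊗₁ λ⇒) ∘ (id ⊗₁ α⇒)                        ≈⟨ sym ρ⇒⊗id∘α⇐ ⟩∘⟨refl ⟩
    ((ρ⇒ ⊗₁ id) ∘ α⇐) ∘ (id ⊗₁ α⇒)                 ≈⟨ pullʳ α⇐∘id⊗α⇒ ⟩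
    (ρ⇒ ⊗₁ id) ∘ (α⇒ ∘ ((α⇐ ⊗₁ id) ∘ α⇐))          ≈⟨ (refl ⟩⊗⟨ sym ⊗-identity) ⟩∘⟨refl ⟩
    (ρ⇒ ⊗₁ (id ⊗₁ id)) ∘ (α⇒ ∘ ((α⇐ ⊗₁ id) ∘ α⇐))  ≈⟨ pullˡ (sym α-natural) ⟩
    (α⇒ ∘ ((ρ⇒ ⊗₁ id) ⊗₁ id)) ∘ ((α⇐ ⊗₁ id) ∘ α⇐)  ≈⟨ pullʳ (pullˡ ⊗id∘⊗id) ⟩
    α⇒ ∘ (((ρ⇒ ⊗₁ id) ∘ α⇐) ⊗₁ id) ∘ α⇐            ≈⟨ refl⟩∘⟨ (ρ⇒⊗id∘α⇐ ⟩⊗⟨ refl) ⟩∘⟨refl ⟩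
    α⇒ ∘ (((id ⊗₁ λ⇒) ⊗₁ id) ∘ α⇐)                 ≈⟨ refl⟩∘⟨ α⇐-natural ⟩
    α⇒ ∘ (α⇐ ∘ (id ⊗₁ (λ⇒ ⊗₁ id)))                 ≈⟨ cancelˡ α-isoʳ ⟩
    id ⊗₁ (λ⇒ ⊗₁ id)                               ∎)

  λ⇒⊗id∘α⇐ : ∀ {X Y} → (λ⇒ {X} ⊗₁ id {Y}) ∘ α⇐ ≈ λ⇒
  λ⇒⊗id∘α⇐ = trans (sym λ⇒∘α⇒ ⟩∘⟨refl) (cancelʳ α-isoʳ)

  id⊗ρ⇒∘α⇒ : ∀ {X Y} → (id ⊗₁ ρ⇒) ∘ α⇒ {X} {Y} {unit} ≈ ρ⇒ {X ⊗₀ Y}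
  id⊗ρ⇒∘α⇒ = ⊗unit-injective (begin
    ((id ⊗₁ ρ⇒) ∘ α⇒) ⊗₁ id                          ≈⟨ sym ⊗id∘⊗id ⟩
    ((id ⊗₁ ρ⇒) ⊗₁ id) ∘ (α⇒ ⊗₁ id)                  ≈⟨ sym (cancelˡ α-isoˡ) ⟩
    α⇐ ∘ (α⇒ ∘ (((id ⊗₁ ρ⇒) ⊗₁ id) ∘ (α⇒ ⊗₁ id)))    ≈⟨ refl⟩∘⟨ pullˡ α-natural ⟩
    α⇐ ∘ (((id ⊗₁ (ρ⇒ ⊗₁ id)) ∘ α⇒) ∘ (α⇒ ⊗₁ id))    ≈⟨ refl⟩∘⟨ (refl ⟩⊗⟨ sym triangle) ⟩∘⟨refl ⟩∘⟨refl ⟩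
    α⇐ ∘ (((id ⊗₁ ((id ⊗₁ λ⇒) ∘ α⇒)) ∘ α⇒) ∘ (α⇒ ⊗₁ id))
      ≈⟨ refl⟩∘⟨ pullʳ refl ⟩
    α⇐ ∘ ((id ⊗₁ ((id ⊗₁ λ⇒) ∘ α⇒)) ∘ (α⇒ ∘ (α⇒ ⊗₁ id)))
      ≈⟨ refl⟩∘⟨ sym id⊗∘id⊗ ⟩∘⟨refl ⟩
    α⇐ ∘ (((id ⊗₁ (id ⊗₁ λ⇒)) ∘ (id ⊗₁ α⇒)) ∘ (α⇒ ∘ (α⇒ ⊗₁ id)))
      ≈⟨ refl⟩∘⟨ pullʳ pentagon ⟩
    α⇐ ∘ ((id ⊗₁ (id ⊗₁ λ⇒)) ∘ (α⇒ ∘ α⇒))            ≈⟨ pullˡ (sym α⇐-natural) ⟩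
    (((id ⊗₁ id) ⊗₁ λ⇒) ∘ α⇐) ∘ (α⇒ ∘ α⇒)            ≈⟨ pullʳ (cancelˡ α-isoˡ) ⟩
    ((id ⊗₁ id) ⊗₁ λ⇒) ∘ α⇒                          ≈⟨ (⊗-identity ⟩⊗⟨ refl) ⟩∘⟨refl ⟩
    (id ⊗₁ λ⇒) ∘ α⇒                                  ≈⟨ triangle ⟩
    ρ⇒ ⊗₁ id                                         ∎)

  ρ⇒∘α⇐ : ∀ {X Y} → ρ⇒ ∘ α⇐ ≈ id {X} ⊗₁ ρ⇒ {Y}
  ρ⇒∘α⇐ = trans (sym id⊗ρ⇒∘α⇒ ⟩∘⟨refl) (cancelʳ α-isoʳ)

  λ⇒∘σ : ∀ {A} → λ⇒ ∘ σ {A} {unit} ≈ ρ⇒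
  λ⇒∘σ = sym (⊗unit-injective (trans (sym (cancelˡ commutative))
                                      (trans (refl⟩∘⟨ σ∘ρ⇒⊗id) (cancelˡ commutative))))
    where
    σ∘ρ⇒⊗id : ∀ {A} → σ ∘ (ρ⇒ {A} ⊗₁ id {unit}) ≈ σ ∘ ((λ⇒ ∘ σ) ⊗₁ id)
    σ∘ρ⇒⊗id = begin
      σ ∘ (ρ⇒ ⊗₁ id)                     ≈⟨ refl⟩∘⟨ sym triangle ⟩
      σ ∘ ((id ⊗₁ λ⇒) ∘ α⇒)              ≈⟨ pullˡ σ-natural ⟩
      ((λ⇒ ⊗₁ id) ∘ σ) ∘ α⇒              ≈⟨ sym λ⇒∘α⇒ ⟩∘⟨refl ⟩∘⟨refl ⟩
      ((λ⇒ ∘ α⇒) ∘ σ) ∘ α⇒               ≈⟨ trans assoc assoc ⟩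
      λ⇒ ∘ (α⇒ ∘ (σ ∘ α⇒))               ≈⟨ refl⟩∘⟨ hexagon ⟩
      λ⇒ ∘ ((id ⊗₁ σ) ∘ (α⇒ ∘ (σ ⊗₁ id))) ≈⟨ pullˡ λ-natural ⟩
      (σ ∘ λ⇒) ∘ (α⇒ ∘ (σ ⊗₁ id))        ≈⟨ pullʳ (pullˡ λ⇒∘α⇒) ⟩
      σ ∘ ((λ⇒ ⊗₁ id) ∘ (σ ⊗₁ id))       ≈⟨ refl⟩∘⟨ ⊗id∘⊗id ⟩
      σ ∘ ((λ⇒ ∘ σ) ⊗₁ id)               ∎

  ρ⇒∘σ : ∀ {A} → ρ⇒ ∘ σ {unit} {A} ≈ λ⇒
  ρ⇒∘σ = trans (sym λ⇒∘σ ⟩∘⟨refl) (trans assoc (elimʳ commutative))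

  -- interchange = α⇐ ∘ (id ⊗₁ shuffle) ∘ α⇒
  shuffle : ∀ {B C D} → B ⊗₀ (C ⊗₀ D) ⇒ C ⊗₀ (B ⊗₀ D)
  shuffle = α⇒ ∘ ((σ ⊗₁ id) ∘ α⇐)

  shuffle-natural : ∀ {B C D B' C' D'} {g : B ⇒ B'} {h : C ⇒ C'} {k : D ⇒ D'} →
                    shuffle ∘ (g ⊗₁ (h ⊗₁ k)) ≈ (h ⊗₁ (g ⊗₁ k)) ∘ shuffle
  shuffle-natural {g = g} {h} {k} = begin
    (α⇒ ∘ ((σ ⊗₁ id) ∘ α⇐)) ∘ (g ⊗₁ (h ⊗₁ k)) ≈⟨ pullʳ (pullʳ (sym α⇐-natural)) ⟩
    α⇒ ∘ ((σ ⊗₁ id) ∘ (((g ⊗₁ h) ⊗₁ k) ∘ α⇐)) ≈⟨ refl⟩∘⟨ pullˡ σ⊗id-natural ⟩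
    α⇒ ∘ ((((h ⊗₁ g) ⊗₁ k) ∘ (σ ⊗₁ id)) ∘ α⇐) ≈⟨ refl⟩∘⟨ assoc ⟩
    α⇒ ∘ (((h ⊗₁ g) ⊗₁ k) ∘ ((σ ⊗₁ id) ∘ α⇐)) ≈⟨ pullˡ α-natural ⟩
    ((h ⊗₁ (g ⊗₁ k)) ∘ α⇒) ∘ ((σ ⊗₁ id) ∘ α⇐) ≈⟨ assoc ⟩
    (h ⊗₁ (g ⊗₁ k)) ∘ shuffle                 ∎
    where
    σ⊗id-natural : (σ ⊗₁ id) ∘ ((g ⊗₁ h) ⊗₁ k) ≈ ((h ⊗₁ g) ⊗₁ k) ∘ (σ ⊗₁ id)
    σ⊗id-natural = trans ⊗∘⊗ (trans (σ-natural ⟩⊗⟨ id-comm) ⊗-homomorphism)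

  shuffle-involutive : ∀ {B C D} → shuffle {C} {B} {D} ∘ shuffle {B} {C} {D} ≈ id
  shuffle-involutive = begin
    (α⇒ ∘ ((σ ⊗₁ id) ∘ α⇐)) ∘ (α⇒ ∘ ((σ ⊗₁ id) ∘ α⇐)) ≈⟨ pullʳ (cancelInner α-isoˡ) ⟩
    α⇒ ∘ ((σ ⊗₁ id) ∘ ((σ ⊗₁ id) ∘ α⇐))               ≈⟨ refl⟩∘⟨ cancelˡ (⊗id-iso commutative) ⟩
    α⇒ ∘ α⇐                                           ≈⟨ α-isoʳ ⟩
    id                                                ∎

  interchange-natural : ∀ {A B C D A' B' C' D'}
                          {f : A ⇒ A'} {g : B ⇒ B'} {h : C ⇒ C'} {k : D ⇒ D'} →
                        interchange ∘ ((f ⊗₁ g) ⊗₁ (h ⊗₁ k)) ≈ ((f ⊗₁ h) ⊗₁ (g ⊗₁ k)) ∘ interchange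
  interchange-natural {f = f} {g} {h} {k} = begin
    (α⇐ ∘ ((id ⊗₁ shuffle) ∘ α⇒)) ∘ ((f ⊗₁ g) ⊗₁ (h ⊗₁ k)) ≈⟨ pullʳ (pullʳ α-natural) ⟩
    α⇐ ∘ ((id ⊗₁ shuffle) ∘ ((f ⊗₁ (g ⊗₁ (h ⊗₁ k))) ∘ α⇒)) ≈⟨ refl⟩∘⟨ pullˡ id⊗shuffle-natural ⟩
    α⇐ ∘ (((f ⊗₁ (h ⊗₁ (g ⊗₁ k))) ∘ (id ⊗₁ shuffle)) ∘ α⇒) ≈⟨ refl⟩∘⟨ assoc ⟩
    α⇐ ∘ ((f ⊗₁ (h ⊗₁ (g ⊗₁ k))) ∘ ((id ⊗₁ shuffle) ∘ α⇒)) ≈⟨ pullˡ (sym α⇐-natural) ⟩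
    (((f ⊗₁ h) ⊗₁ (g ⊗₁ k)) ∘ α⇐) ∘ ((id ⊗₁ shuffle) ∘ α⇒) ≈⟨ assoc ⟩
    ((f ⊗₁ h) ⊗₁ (g ⊗₁ k)) ∘ interchange                    ∎
    where
    id⊗shuffle-natural : (id ⊗₁ shuffle) ∘ (f ⊗₁ (g ⊗₁ (h ⊗₁ k)))
                         ≈ (f ⊗₁ (h ⊗₁ (g ⊗₁ k))) ∘ (id ⊗₁ shuffle)
    id⊗shuffle-natural = trans ⊗∘⊗ (trans (id-comm ⟩⊗⟨ shuffle-natural) ⊗-homomorphism)

  interchange-involutive : ∀ {A B C D} →
                           interchange {A} {C} {B} {D} ∘ interchange {A} {B} {C} {D} ≈ id
  interchange-involutive = begin
    (α⇐ ∘ ((id ⊗₁ shuffle) ∘ α⇒)) ∘ (α⇐ ∘ ((id ⊗₁ shuffle) ∘ α⇒)) ≈⟨ pullʳ (cancelInner α-isoʳ) ⟩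
    α⇐ ∘ ((id ⊗₁ shuffle) ∘ ((id ⊗₁ shuffle) ∘ α⇒))               ≈⟨ refl⟩∘⟨ cancelˡ (id⊗-iso shuffle-involutive) ⟩
    α⇐ ∘ α⇒                                                       ≈⟨ α-isoˡ ⟩
    id                                                            ∎

  ρ⇒⊗ρ⇒∘interchange : ∀ {X Y} →
                      (ρ⇒ ⊗₁ ρ⇒) ∘ interchange {X} {Y} {unit} {unit} ≈ ρ⇒ ∘ (id ⊗₁ ρ⇒)
  ρ⇒⊗ρ⇒∘interchange = begin
    (ρ⇒ ⊗₁ ρ⇒) ∘ (α⇐ ∘ ((id ⊗₁ shuffle) ∘ α⇒))  ≈⟨ sym-assoc ⟩
    ((ρ⇒ ⊗₁ ρ⇒) ∘ α⇐) ∘ ((id ⊗₁ shuffle) ∘ α⇒)  ≈⟨ ρ⇒⊗ρ⇒∘α⇐ ⟩∘⟨refl ⟩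
    (id ⊗₁ (ρ⇒ ∘ λ⇒)) ∘ ((id ⊗₁ shuffle) ∘ α⇒)  ≈⟨ pullˡ id⊗∘id⊗ ⟩
    (id ⊗₁ ((ρ⇒ ∘ λ⇒) ∘ shuffle)) ∘ α⇒          ≈⟨ (refl ⟩⊗⟨ ρ⇒∘λ⇒∘shuffle) ⟩∘⟨refl ⟩
    (id ⊗₁ (ρ⇒ ∘ (id ⊗₁ ρ⇒))) ∘ α⇒              ≈⟨ sym id⊗∘id⊗ ⟩∘⟨refl ⟩
    ((id ⊗₁ ρ⇒) ∘ (id ⊗₁ (id ⊗₁ ρ⇒))) ∘ α⇒      ≈⟨ pullʳ (sym α-natural) ⟩
    (id ⊗₁ ρ⇒) ∘ (α⇒ ∘ ((id ⊗₁ id) ⊗₁ ρ⇒))      ≈⟨ pullˡ id⊗ρ⇒∘α⇒ ⟩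
    ρ⇒ ∘ ((id ⊗₁ id) ⊗₁ ρ⇒)                     ≈⟨ refl⟩∘⟨ (⊗-identity ⟩⊗⟨ refl) ⟩
    ρ⇒ ∘ (id ⊗₁ ρ⇒)                             ∎
    where
    ρ⇒⊗ρ⇒∘α⇐ : ∀ {X Y} → (ρ⇒ {X} ⊗₁ ρ⇒ {Y}) ∘ α⇐ ≈ id ⊗₁ (ρ⇒ ∘ λ⇒)
    ρ⇒⊗ρ⇒∘α⇐ = trans (serialize₂₁ ⟩∘⟨refl) (trans (pullʳ ρ⇒⊗id∘α⇐) id⊗∘id⊗)

    ρ⇒∘λ⇒∘shuffle : ∀ {Y} → (ρ⇒ ∘ λ⇒) ∘ shuffle {Y} {unit} {unit} ≈ ρ⇒ ∘ (id ⊗₁ ρ⇒)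
    ρ⇒∘λ⇒∘shuffle = begin
      (ρ⇒ ∘ λ⇒) ∘ (α⇒ ∘ ((σ ⊗₁ id) ∘ α⇐)) ≈⟨ pullʳ (pullˡ λ⇒∘α⇒) ⟩
      ρ⇒ ∘ ((λ⇒ ⊗₁ id) ∘ ((σ ⊗₁ id) ∘ α⇐)) ≈⟨ refl⟩∘⟨ pullˡ (trans ⊗id∘⊗id (λ⇒∘σ ⟩⊗⟨ refl)) ⟩
      ρ⇒ ∘ ((ρ⇒ ⊗₁ id) ∘ α⇐)               ≈⟨ pullˡ ρ-natural ⟩
      (ρ⇒ ∘ ρ⇒) ∘ α⇐                       ≈⟨ pullʳ ρ⇒∘α⇐ ⟩
      ρ⇒ ∘ (id ⊗₁ ρ⇒)                      ∎

  λ⇒⊗λ⇒∘interchange : ∀ {X Y} →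
                      (λ⇒ ⊗₁ λ⇒) ∘ interchange {unit} {unit} {X} {Y} ≈ λ⇒ ∘ (λ⇒ ⊗₁ id)
  λ⇒⊗λ⇒∘interchange = begin
    (λ⇒ ⊗₁ λ⇒) ∘ (α⇐ ∘ ((id ⊗₁ shuffle) ∘ α⇒))           ≈⟨ pullˡ λ⇒⊗λ⇒∘α⇐ ⟩
    (λ⇒ ∘ (id ⊗₁ (id ⊗₁ λ⇒))) ∘ ((id ⊗₁ shuffle) ∘ α⇒)   ≈⟨ pullʳ (pullˡ id⊗∘id⊗) ⟩
    λ⇒ ∘ ((id ⊗₁ ((id ⊗₁ λ⇒) ∘ shuffle)) ∘ α⇒)           ≈⟨ pullˡ λ-natural ⟩
    (((id ⊗₁ λ⇒) ∘ shuffle) ∘ λ⇒) ∘ α⇒                   ≈⟨ pullʳ λ⇒∘α⇒ ⟩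
    ((id ⊗₁ λ⇒) ∘ shuffle) ∘ (λ⇒ ⊗₁ id)                  ≈⟨ id⊗λ⇒∘shuffle ⟩∘⟨refl ⟩
    λ⇒ ∘ (λ⇒ ⊗₁ id)                                      ∎
    where
    λ⇒⊗λ⇒∘α⇐ : ∀ {X Y} → (λ⇒ ⊗₁ λ⇒) ∘ α⇐ ≈ λ⇒ ∘ (id ⊗₁ (id {X} ⊗₁ λ⇒ {Y}))
    λ⇒⊗λ⇒∘α⇐ = begin
      (λ⇒ ⊗₁ λ⇒) ∘ α⇐                           ≈⟨ serialize₁₂ ⟩∘⟨refl ⟩
      ((λ⇒ ⊗₁ id) ∘ (id ⊗₁ λ⇒)) ∘ α⇐            ≈⟨ pullʳ ((sym ⊗-identity ⟩⊗⟨ refl) ⟩∘⟨refl) ⟩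
      (λ⇒ ⊗₁ id) ∘ (((id ⊗₁ id) ⊗₁ λ⇒) ∘ α⇐)    ≈⟨ refl⟩∘⟨ α⇐-natural ⟩
      (λ⇒ ⊗₁ id) ∘ (α⇐ ∘ (id ⊗₁ (id ⊗₁ λ⇒)))    ≈⟨ pullˡ λ⇒⊗id∘α⇐ ⟩
      λ⇒ ∘ (id ⊗₁ (id ⊗₁ λ⇒))                   ∎

    id⊗λ⇒∘shuffle : ∀ {X Y} → (id ⊗₁ λ⇒) ∘ shuffle {unit} {X} {Y} ≈ λ⇒
    id⊗λ⇒∘shuffle = begin
      (id ⊗₁ λ⇒) ∘ (α⇒ ∘ ((σ ⊗₁ id) ∘ α⇐)) ≈⟨ pullˡ triangle ⟩
      (ρ⇒ ⊗₁ id) ∘ ((σ ⊗₁ id) ∘ α⇐)        ≈⟨ pullˡ (trans ⊗id∘⊗id (ρ⇒∘σ ⟩⊗⟨ refl)) ⟩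
      (λ⇒ ⊗₁ id) ∘ α⇐                      ≈⟨ λ⇒⊗id∘α⇐ ⟩
      λ⇒                                   ∎

  module TerminalUnit (! : ∀ {A} → A ⇒ unit) (!-unique : ∀ {A} (f : A ⇒ unit) → f ≈ !) where

    !-unique₂ : ∀ {A} {f g : A ⇒ unit} → f ≈ g
    !-unique₂ {f = f} {g} = trans (!-unique f) (sym (!-unique g))

    π₁ : ∀ {A B} → A ⊗₀ B ⇒ A
    π₁ = ρ⇒ ∘ (id ⊗₁ !)

    π₂ : ∀ {A B} → A ⊗₀ B ⇒ B
    π₂ = λ⇒ ∘ (! ⊗₁ id)

    π₁-natural : ∀ {A B X Y} {f : A ⇒ B} {g : X ⇒ Y} → π₁ ∘ (f ⊗₁ g) ≈ f ∘ π₁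
    π₁-natural {f = f} {g} = begin
      (ρ⇒ ∘ (id ⊗₁ !)) ∘ (f ⊗₁ g)  ≈⟨ pullʳ ⊗∘⊗ ⟩
      ρ⇒ ∘ ((id ∘ f) ⊗₁ (! ∘ g))   ≈⟨ refl⟩∘⟨ (id-comm ⟩⊗⟨ trans !-unique₂ (sym identityˡ)) ⟩
      ρ⇒ ∘ ((f ∘ id) ⊗₁ (id ∘ !))  ≈⟨ refl⟩∘⟨ ⊗-homomorphism ⟩
      ρ⇒ ∘ ((f ⊗₁ id) ∘ (id ⊗₁ !)) ≈⟨ pullˡ ρ-natural ⟩
      (f ∘ ρ⇒) ∘ (id ⊗₁ !)         ≈⟨ assoc ⟩
      f ∘ π₁                       ∎

    π₂-natural : ∀ {A B X Y} {f : A ⇒ B} {g : X ⇒ Y} → π₂ ∘ (f ⊗₁ g) ≈ g ∘ π₂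
    π₂-natural {f = f} {g} = begin
      (λ⇒ ∘ (! ⊗₁ id)) ∘ (f ⊗₁ g)  ≈⟨ pullʳ ⊗∘⊗ ⟩
      λ⇒ ∘ ((! ∘ f) ⊗₁ (id ∘ g))   ≈⟨ refl⟩∘⟨ (trans !-unique₂ (sym identityˡ) ⟩⊗⟨ id-comm) ⟩
      λ⇒ ∘ ((id ∘ !) ⊗₁ (g ∘ id))  ≈⟨ refl⟩∘⟨ ⊗-homomorphism ⟩
      λ⇒ ∘ ((id ⊗₁ g) ∘ (! ⊗₁ id)) ≈⟨ pullˡ λ-natural ⟩
      (g ∘ λ⇒) ∘ (! ⊗₁ id)         ≈⟨ assoc ⟩
      g ∘ π₂                       ∎

    λ⇒≈π₂ : λ⇒ {unit} ≈ π₂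
    λ⇒≈π₂ = sym (elimʳ (trans (!-unique₂ ⟩⊗⟨ refl) ⊗-identity))

    interchange-unit : ∀ {X W} → interchange {X} {unit} {unit} {W} ≈ id
    interchange-unit = begin
      α⇐ ∘ ((id ⊗₁ (α⇒ ∘ ((σ ⊗₁ id) ∘ α⇐))) ∘ α⇒)
        ≈⟨ refl⟩∘⟨ (refl ⟩⊗⟨ (refl⟩∘⟨ elimˡ (trans (σ≈id ⟩⊗⟨ refl) ⊗-identity))) ⟩∘⟨refl ⟩
      α⇐ ∘ ((id ⊗₁ (α⇒ ∘ α⇐)) ∘ α⇒) ≈⟨ refl⟩∘⟨ elimˡ (trans (refl ⟩⊗⟨ α-isoʳ) ⊗-identity) ⟩
      α⇐ ∘ α⇒                       ≈⟨ α-isoˡ ⟩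
      id                            ∎
      where
      -- both are maps into I ⊗ I ≅ I, which is terminal
      σ≈id : σ {unit} {unit} ≈ id
      σ≈id = trans (sym (cancelˡ λ-isoˡ)) (trans (refl⟩∘⟨ !-unique₂) (cancelˡ λ-isoˡ))

    π₁⊗π₂∘interchange : ∀ {X Y Z W} → (π₁ ⊗₁ π₂) ∘ interchange {X} {Y} {Z} {W} ≈ π₁ ⊗₁ π₂
    π₁⊗π₂∘interchange = begin
      ((ρ⇒ ∘ (id ⊗₁ !)) ⊗₁ (λ⇒ ∘ (! ⊗₁ id))) ∘ interchange       ≈⟨ ⊗-homomorphism ⟩∘⟨refl ⟩
      ((ρ⇒ ⊗₁ λ⇒) ∘ ((id ⊗₁ !) ⊗₁ (! ⊗₁ id))) ∘ interchange       ≈⟨ pullʳ (sym interchange-natural) ⟩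
      (ρ⇒ ⊗₁ λ⇒) ∘ (interchange ∘ ((id ⊗₁ !) ⊗₁ (! ⊗₁ id)))       ≈⟨ refl⟩∘⟨ elimˡ interchange-unit ⟩
      (ρ⇒ ⊗₁ λ⇒) ∘ ((id ⊗₁ !) ⊗₁ (! ⊗₁ id))                       ≈⟨ ⊗∘⊗ ⟩
      π₁ ⊗₁ π₂                                                    ∎

    π₁⊗π₁∘interchange : ∀ {X Y Z W} → (π₁ ⊗₁ π₁) ∘ interchange {X} {Y} {Z} {W} ≈ π₁
    π₁⊗π₁∘interchange = begin
      ((ρ⇒ ∘ (id ⊗₁ !)) ⊗₁ (ρ⇒ ∘ (id ⊗₁ !))) ∘ interchange ≈⟨ ⊗-homomorphism ⟩∘⟨refl ⟩
      ((ρ⇒ ⊗₁ ρ⇒) ∘ ((id ⊗₁ !) ⊗₁ (id ⊗₁ !))) ∘ interchange ≈⟨ pullʳ (sym interchange-natural) ⟩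
      (ρ⇒ ⊗₁ ρ⇒) ∘ (interchange ∘ ((id ⊗₁ id) ⊗₁ (! ⊗₁ !))) ≈⟨ pullˡ ρ⇒⊗ρ⇒∘interchange ⟩
      (ρ⇒ ∘ (id ⊗₁ ρ⇒)) ∘ ((id ⊗₁ id) ⊗₁ (! ⊗₁ !))          ≈⟨ pullʳ (trans ⊗∘⊗ (trans identityˡ ⊗-identity ⟩⊗⟨ !-unique₂)) ⟩
      ρ⇒ ∘ (id ⊗₁ !)                                        ∎

    π₁∘interchange : ∀ {X Y Z W} → π₁ ∘ interchange {X} {Y} {Z} {W} ≈ π₁ ⊗₁ π₁
    π₁∘interchange = trans (sym π₁⊗π₁∘interchange ⟩∘⟨refl) (cancelʳ interchange-involutive)

    π₂⊗π₂∘interchange : ∀ {X Y Z W} → (π₂ ⊗₁ π₂) ∘ interchange {X} {Y} {Z} {W} ≈ π₂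
    π₂⊗π₂∘interchange = begin
      ((λ⇒ ∘ (! ⊗₁ id)) ⊗₁ (λ⇒ ∘ (! ⊗₁ id))) ∘ interchange ≈⟨ ⊗-homomorphism ⟩∘⟨refl ⟩
      ((λ⇒ ⊗₁ λ⇒) ∘ ((! ⊗₁ id) ⊗₁ (! ⊗₁ id))) ∘ interchange ≈⟨ pullʳ (sym interchange-natural) ⟩
      (λ⇒ ⊗₁ λ⇒) ∘ (interchange ∘ ((! ⊗₁ !) ⊗₁ (id ⊗₁ id))) ≈⟨ pullˡ λ⇒⊗λ⇒∘interchange ⟩
      (λ⇒ ∘ (λ⇒ ⊗₁ id)) ∘ ((! ⊗₁ !) ⊗₁ (id ⊗₁ id))          ≈⟨ pullʳ (trans ⊗∘⊗ (!-unique₂ ⟩⊗⟨ trans identityˡ ⊗-identity)) ⟩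
      λ⇒ ∘ (! ⊗₁ id)                                        ∎

    π₂∘interchange : ∀ {X Y Z W} → π₂ ∘ interchange {X} {Y} {Z} {W} ≈ π₂ ⊗₁ π₂
    π₂∘interchange = trans (sym π₂⊗π₂∘interchange ⟩∘⟨refl) (cancelʳ interchange-involutive)

module CartesianComonad {o ℓ e} (𝒞 : SymmetricMonoidalCategory o ℓ e)
                        (cartesian : IsCartesianMonoidal 𝒞) where
  open MonoidalLemmas 𝒞
  open IsCartesianMonoidal cartesian
  open TerminalUnit ! !-unique
  open Sequences 𝒞 using (List⁺₀; List⁺₁; List⁺; ψ)
  open Endofunctor List⁺ using ()
    renaming (homomorphism to List⁺-homomorphism; F-resp-≈ to List⁺-resp-≈)

  π-jointly-monic : ∀ {Z A B} {h k : Z ⇒ A ⊗₀ B} →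
                    π₁ ∘ h ≈ π₁ ∘ k → π₂ ∘ h ≈ π₂ ∘ k → h ≈ k
  π-jointly-monic {h = h} {k} p q =
    trans (unique h refl refl) (sym (unique k (sym p) (sym q)))

  ⟨⟩-cong : ∀ {Z A B} {f f' : Z ⇒ A} {g g' : Z ⇒ B} → f ≈ f' → g ≈ g' → ⟨ f , g ⟩ ≈ ⟨ f' , g' ⟩
  ⟨⟩-cong p q = unique _ (trans project₁ p) (trans project₂ q)

  ⟨⟩∘ : ∀ {Y Z A B} {f : Z ⇒ A} {g : Z ⇒ B} {h : Y ⇒ Z} → ⟨ f , g ⟩ ∘ h ≈ ⟨ f ∘ h , g ∘ h ⟩
  ⟨⟩∘ = unique _ (pullˡ project₁) (pullˡ project₂)

  ⊗∘⟨⟩ : ∀ {Z A B A' B'} {a : A ⇒ A'} {b : B ⇒ B'} {f : Z ⇒ A} {g : Z ⇒ B} →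
         (a ⊗₁ b) ∘ ⟨ f , g ⟩ ≈ ⟨ a ∘ f , b ∘ g ⟩
  ⊗∘⟨⟩ = unique _ (trans (pullˡ π₁-natural) (pullʳ project₁))
                  (trans (pullˡ π₂-natural) (pullʳ project₂))

  ⟨π₁,π₂⟩≈id : ∀ {A B} → ⟨ π₁ , π₂ ⟩ ≈ id {A ⊗₀ B}
  ⟨π₁,π₂⟩≈id = sym (unique id identityʳ identityʳ)

  last : ∀ X n → List⁺₀ X n ⇒ X n
  last X zero    = id
  last X (suc n) = π₂

  prefixes : ∀ X n → List⁺₀ X n ⇒ List⁺₀ (List⁺₀ X) n
  prefixes X zero    = id
  prefixes X (suc n) = ⟨ prefixes X n ∘ π₁ , id ⟩

  last-natural : ∀ {X Y} (f : ∀ n → X n ⇒ Y n) n → last Y n ∘ List⁺₁ f n ≈ f n ∘ last X n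
  last-natural f zero    = id-comm
  last-natural f (suc n) = π₂-natural

  prefixes-natural : ∀ {X Y} (f : ∀ n → X n ⇒ Y n) n →
                     prefixes Y n ∘ List⁺₁ f n ≈ List⁺₁ (List⁺₁ f) n ∘ prefixes X n
  prefixes-natural f zero = id-comm
  prefixes-natural {X} {Y} f (suc n) = begin
    ⟨ prefixes Y n ∘ π₁ , id ⟩ ∘ (List⁺₁ f n ⊗₁ f (suc n))
      ≈⟨ ⟨⟩∘ ⟩
    ⟨ (prefixes Y n ∘ π₁) ∘ (List⁺₁ f n ⊗₁ f (suc n)) , id ∘ (List⁺₁ f n ⊗₁ f (suc n)) ⟩
      ≈⟨ ⟨⟩-cong (trans (pullʳ π₁-natural) (trans (pullˡ (prefixes-natural f n)) assoc)) id-comm ⟩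
    ⟨ List⁺₁ (List⁺₁ f) n ∘ (prefixes X n ∘ π₁) , (List⁺₁ f n ⊗₁ f (suc n)) ∘ id ⟩
      ≈⟨ ⊗∘⟨⟩ ⟨
    (List⁺₁ (List⁺₁ f) n ⊗₁ (List⁺₁ f n ⊗₁ f (suc n))) ∘ ⟨ prefixes X n ∘ π₁ , id ⟩ ∎

  List⁺-last∘prefixes : ∀ X n → List⁺₁ (last X) n ∘ prefixes X n ≈ id
  List⁺-last∘prefixes X zero    = identityˡ
  List⁺-last∘prefixes X (suc n) =
    trans ⊗∘⟨⟩ (trans (⟨⟩-cong (cancelˡ (List⁺-last∘prefixes X n)) identityʳ) ⟨π₁,π₂⟩≈id)

  last∘prefixes : ∀ X n → last (List⁺₀ X) n ∘ prefixes X n ≈ id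
  last∘prefixes X zero    = identityˡ
  last∘prefixes X (suc n) = project₂

  prefixes-coassoc : ∀ X n → List⁺₁ (prefixes X) n ∘ prefixes X n
                             ≈ prefixes (List⁺₀ X) n ∘ prefixes X n
  prefixes-coassoc X zero    = refl
  prefixes-coassoc X (suc n) = begin
    (List⁺₁ (prefixes X) n ⊗₁ prefixes X (suc n)) ∘ ⟨ prefixes X n ∘ π₁ , id ⟩
      ≈⟨ ⊗∘⟨⟩ ⟩
    ⟨ List⁺₁ (prefixes X) n ∘ (prefixes X n ∘ π₁) , prefixes X (suc n) ∘ id ⟩
      ≈⟨ ⟨⟩-cong (trans (pullˡ (prefixes-coassoc X n)) (pullʳ (sym project₁))) (sym id-comm) ⟩
    ⟨ prefixes (List⁺₀ X) n ∘ (π₁ ∘ prefixes X (suc n)) , id ∘ prefixes X (suc n) ⟩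
      ≈⟨ trans ⟨⟩∘ (⟨⟩-cong assoc refl) ⟨
    prefixes (List⁺₀ X) (suc n) ∘ prefixes X (suc n) ∎

  π₁∘ψ : ∀ X Y n → π₁ ∘ ψ X Y n ≈ List⁺₁ (λ m → π₁ {X m} {Y m}) n
  π₁∘ψ X Y zero    = identityʳ
  π₁∘ψ X Y (suc n) = trans (pullˡ π₁∘interchange) (trans ⊗∘⊗ (π₁∘ψ X Y n ⟩⊗⟨ identityʳ))

  π₂∘ψ : ∀ X Y n → π₂ ∘ ψ X Y n ≈ List⁺₁ (λ m → π₂ {X m} {Y m}) n
  π₂∘ψ X Y zero    = identityʳ
  π₂∘ψ X Y (suc n) = trans (pullˡ π₂∘interchange) (trans ⊗∘⊗ (π₂∘ψ X Y n ⟩⊗⟨ identityʳ))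

  last-monoidal-⊗ : ∀ X Y n → last (λ m → X m ⊗₀ Y m) n ≈ (last X n ⊗₁ last Y n) ∘ ψ X Y n
  last-monoidal-⊗ X Y n = π-jointly-monic
    (begin
      π₁ ∘ last _ n                        ≈⟨ last-natural (λ m → π₁) n ⟨
      last X n ∘ List⁺₁ (λ m → π₁) n       ≈⟨ refl⟩∘⟨ π₁∘ψ X Y n ⟨
      last X n ∘ (π₁ ∘ ψ X Y n)            ≈⟨ pullˡ (sym π₁-natural) ⟩
      (π₁ ∘ (last X n ⊗₁ last Y n)) ∘ ψ X Y n ≈⟨ assoc ⟩
      π₁ ∘ ((last X n ⊗₁ last Y n) ∘ ψ X Y n) ∎)
    (begin
      π₂ ∘ last _ n                        ≈⟨ last-natural (λ m → π₂) n ⟨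
      last Y n ∘ List⁺₁ (λ m → π₂) n       ≈⟨ refl⟩∘⟨ π₂∘ψ X Y n ⟨
      last Y n ∘ (π₂ ∘ ψ X Y n)            ≈⟨ pullˡ (sym π₂-natural) ⟩
      (π₂ ∘ (last X n ⊗₁ last Y n)) ∘ ψ X Y n ≈⟨ assoc ⟩
      π₂ ∘ ((last X n ⊗₁ last Y n) ∘ ψ X Y n) ∎)

  prefixes-monoidal-⊗ : ∀ X Y n →
    (ψ (List⁺₀ X) (List⁺₀ Y) n ∘ List⁺₁ (ψ X Y) n) ∘ prefixes (λ m → X m ⊗₀ Y m) n
    ≈ (prefixes X n ⊗₁ prefixes Y n) ∘ ψ X Y n
  prefixes-monoidal-⊗ X Y n = π-jointly-monic
    (begin
      π₁ ∘ ((ψ _ _ n ∘ List⁺₁ (ψ X Y) n) ∘ prefixes _ n)  ≈⟨ pullˡ (pullˡ (π₁∘ψ (List⁺₀ X) (List⁺₀ Y) n)) ⟩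
      (List⁺₁ (λ m → π₁) n ∘ List⁺₁ (ψ X Y) n) ∘ prefixes _ n ≈⟨ sym (List⁺-homomorphism n) ⟩∘⟨refl ⟩
      List⁺₁ (λ m → π₁ ∘ ψ X Y m) n ∘ prefixes _ n       ≈⟨ List⁺-resp-≈ (π₁∘ψ X Y) n ⟩∘⟨refl ⟩
      List⁺₁ (List⁺₁ (λ m → π₁)) n ∘ prefixes _ n        ≈⟨ prefixes-natural (λ m → π₁) n ⟨
      prefixes X n ∘ List⁺₁ (λ m → π₁) n                 ≈⟨ refl⟩∘⟨ π₁∘ψ X Y n ⟨
      prefixes X n ∘ (π₁ ∘ ψ X Y n)                      ≈⟨ pullˡ (sym π₁-natural) ⟩
      (π₁ ∘ (prefixes X n ⊗₁ prefixes Y n)) ∘ ψ X Y n    ≈⟨ assoc ⟩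
      π₁ ∘ ((prefixes X n ⊗₁ prefixes Y n) ∘ ψ X Y n)    ∎)
    (begin
      π₂ ∘ ((ψ _ _ n ∘ List⁺₁ (ψ X Y) n) ∘ prefixes _ n)  ≈⟨ pullˡ (pullˡ (π₂∘ψ (List⁺₀ X) (List⁺₀ Y) n)) ⟩
      (List⁺₁ (λ m → π₂) n ∘ List⁺₁ (ψ X Y) n) ∘ prefixes _ n ≈⟨ sym (List⁺-homomorphism n) ⟩∘⟨refl ⟩
      List⁺₁ (λ m → π₂ ∘ ψ X Y m) n ∘ prefixes _ n       ≈⟨ List⁺-resp-≈ (π₂∘ψ X Y) n ⟩∘⟨refl ⟩
      List⁺₁ (List⁺₁ (λ m → π₂)) n ∘ prefixes _ n        ≈⟨ prefixes-natural (λ m → π₂) n ⟨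
      prefixes Y n ∘ List⁺₁ (λ m → π₂) n                 ≈⟨ refl⟩∘⟨ π₂∘ψ X Y n ⟨
      prefixes Y n ∘ (π₂ ∘ ψ X Y n)                      ≈⟨ pullˡ (sym π₂-natural) ⟩
      (π₂ ∘ (prefixes X n ⊗₁ prefixes Y n)) ∘ ψ X Y n    ≈⟨ assoc ⟩
      π₂ ∘ ((prefixes X n ⊗₁ prefixes Y n) ∘ ψ X Y n)    ∎)

  List⁺-comonad : List⁺-OplaxMonoidalComonad 𝒞
  List⁺-comonad = record
    { ε               = last
    ; δ               = prefixes
    ; ε-natural       = last-natural
    ; δ-natural       = prefixes-natural
    ; counitˡ         = List⁺-last∘prefixes
    ; counitʳ         = last∘prefixes
    ; coassoc         = prefixes-coassoc
    ; ε-monoidal-unit = λ n → !-unique₂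
    ; ε-monoidal-⊗    = λ X Y n → trans identityˡ (last-monoidal-⊗ X Y n)
    ; δ-monoidal-unit = λ n → !-unique₂
    ; δ-monoidal-⊗    = prefixes-monoidal-⊗
    }

module ComonadCartesian {o ℓ e} (𝒞 : SymmetricMonoidalCategory o ℓ e)
                        (comonad : List⁺-OplaxMonoidalComonad 𝒞) where
  open MonoidalLemmas 𝒞
  open Sequences 𝒞 using (List⁺₀; List⁺₁; ψ)
  open OplaxMonoidalComonad comonad

  [_,I,I,…] : Obj → ℕ → Obj
  [ A ,I,I,…] zero    = A
  [ A ,I,I,…] (suc _) = unit

  [_,id,id,…] : ∀ {A B} → A ⇒ B → ∀ n → [ A ,I,I,…] n ⇒ [ B ,I,I,…] n
  [ f ,id,id,…] zero    = f
  [ f ,id,id,…] (suc _) = id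

  ε₀ : ∀ A → A ⇒ A
  ε₀ A = ε [ A ,I,I,…] 0

  ε₁ : ∀ A → A ⊗₀ unit ⇒ unit
  ε₁ A = ε [ A ,I,I,…] 1

  δ₁ : ∀ A → A ⊗₀ unit ⇒ A ⊗₀ (A ⊗₀ unit)
  δ₁ A = δ [ A ,I,I,…] 1

  ε₁-determined : ∀ {A} (f : A ⇒ unit) → ε₁ A ≈ λ⇒ ∘ (f ⊗₁ id)
  ε₁-determined {A} f = begin
    ε₁ A                                ≈⟨ identityˡ ⟨
    id ∘ ε₁ A                           ≈⟨ ε-natural f-then-id 1 ⟨
    ε (λ _ → unit) 1 ∘ (f ⊗₁ id)        ≈⟨ identityˡ ⟩∘⟨refl ⟨
    (id ∘ ε (λ _ → unit) 1) ∘ (f ⊗₁ id) ≈⟨ ε-monoidal-unit 1 ⟩∘⟨refl ⟩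
    (λ⇒ ∘ (id ⊗₁ id)) ∘ (f ⊗₁ id)       ≈⟨ elimʳ ⊗-identity ⟩∘⟨refl ⟩
    λ⇒ ∘ (f ⊗₁ id)                      ∎
    where
    f-then-id : ∀ n → [ A ,I,I,…] n ⇒ unit
    f-then-id zero    = f
    f-then-id (suc _) = id

  -- solves ε₁ A ≈ λ⇒ ∘ (f ⊗₁ id) ≈ λ⇒ ∘ ρ⇐ ∘ f ∘ ρ⇒ for f
  ! : ∀ {A} → A ⇒ unit
  ! {A} = (ρ⇒ ∘ λ⇐) ∘ (ε₁ A ∘ ρ⇐)

  !-unique : ∀ {A} (f : A ⇒ unit) → f ≈ !
  !-unique {A} f = sym (begin
    (ρ⇒ ∘ λ⇐) ∘ (ε₁ A ∘ ρ⇐)             ≈⟨ refl⟩∘⟨ ε₁-determined f ⟩∘⟨refl ⟩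
    (ρ⇒ ∘ λ⇐) ∘ ((λ⇒ ∘ (f ⊗₁ id)) ∘ ρ⇐) ≈⟨ pullʳ (pullˡ (cancelˡ λ-isoˡ)) ⟩
    ρ⇒ ∘ ((f ⊗₁ id) ∘ ρ⇐)               ≈⟨ refl⟩∘⟨ ρ⇐-natural ⟩
    ρ⇒ ∘ (ρ⇐ ∘ f)                       ≈⟨ cancelˡ ρ-isoʳ ⟩
    f                                   ∎)

  open TerminalUnit ! !-unique

  withUnitHead : (ℕ → Obj) → ℕ → Obj
  withUnitHead W zero    = unit
  withUnitHead W (suc n) = W (suc n)

  withUnitHead₁ : ∀ {W W'} → (∀ n → W n ⇒ W' n) → ∀ n → withUnitHead W n ⇒ withUnitHead W' n
  withUnitHead₁ f zero    = id
  withUnitHead₁ f (suc n) = f (suc n)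

  !-head : ∀ {W} n → W n ⇒ withUnitHead W n
  !-head zero    = !
  !-head (suc n) = id

  -- Stands in for ρ⇒ on the second factor of δ₁ A: unlike ρ⇒, it is what the
  -- counit law at List⁺ [ A ,I,I,…] controls (see ρ′∘π₂∘δ₁).
  ε-tail : ∀ A → unit ⊗₀ (A ⊗₀ unit) ⇒ A ⊗₀ unit
  ε-tail A = ε (withUnitHead (List⁺₀ [ A ,I,I,…])) 1

  ρ′ : ∀ A → A ⊗₀ unit ⇒ A
  ρ′ A = ρ⇒ ∘ (ε-tail A ∘ λ⇐)

  Δ : ∀ A → A ⇒ A ⊗₀ A
  Δ A = (ε₀ A ⊗₁ ρ′ A) ∘ (δ₁ A ∘ ρ⇐)

  ε₀∘π₁∘δ₁ : ∀ {A} → ε₀ A ∘ (π₁ ∘ δ₁ A) ≈ ρ⇒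
  ε₀∘π₁∘δ₁ {A} = begin
    ε₀ A ∘ ((ρ⇒ ∘ (id ⊗₁ !)) ∘ δ₁ A)          ≈⟨ pullˡ (pullˡ (sym ρ-natural)) ⟩
    ((ρ⇒ ∘ (ε₀ A ⊗₁ id)) ∘ (id ⊗₁ !)) ∘ δ₁ A  ≈⟨ pullʳ (sym serialize₁₂) ⟩∘⟨refl ⟩
    (ρ⇒ ∘ (ε₀ A ⊗₁ !)) ∘ δ₁ A                 ≈⟨ (refl⟩∘⟨ (refl ⟩⊗⟨ !-unique₂)) ⟩∘⟨refl ⟩
    (ρ⇒ ∘ (ε₀ A ⊗₁ ε₁ A)) ∘ δ₁ A              ≈⟨ pullʳ (counitˡ [ A ,I,I,…] 1) ⟩
    ρ⇒ ∘ id                                   ≈⟨ identityʳ ⟩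
    ρ⇒                                        ∎

  ρ′∘π₂∘δ₁ : ∀ {A} → ρ′ A ∘ (π₂ ∘ δ₁ A) ≈ ρ⇒
  ρ′∘π₂∘δ₁ {A} = begin
    (ρ⇒ ∘ (ε-tail A ∘ λ⇐)) ∘ ((λ⇒ ∘ (! ⊗₁ id)) ∘ δ₁ A)  ≈⟨ pullʳ (pullʳ (refl⟩∘⟨ assoc)) ⟩
    ρ⇒ ∘ (ε-tail A ∘ (λ⇐ ∘ (λ⇒ ∘ ((! ⊗₁ id) ∘ δ₁ A))))   ≈⟨ refl⟩∘⟨ refl⟩∘⟨ cancelˡ λ-isoˡ ⟩
    ρ⇒ ∘ (ε-tail A ∘ ((! ⊗₁ id) ∘ δ₁ A))                ≈⟨ refl⟩∘⟨ pullˡ (ε-natural !-head 1) ⟩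
    ρ⇒ ∘ ((id ∘ ε (List⁺₀ [ A ,I,I,…]) 1) ∘ δ₁ A)    ≈⟨ refl⟩∘⟨ pullʳ (counitʳ [ A ,I,I,…] 1) ⟩
    ρ⇒ ∘ (id ∘ id)                                   ≈⟨ elimʳ identityˡ ⟩
    ρ⇒                                               ∎

  π₁∘Δ : ∀ {A} → π₁ ∘ Δ A ≈ id
  π₁∘Δ {A} = begin
    π₁ ∘ ((ε₀ A ⊗₁ ρ′ A) ∘ (δ₁ A ∘ ρ⇐)) ≈⟨ pullˡ π₁-natural ⟩
    (ε₀ A ∘ π₁) ∘ (δ₁ A ∘ ρ⇐)           ≈⟨ pullʳ sym-assoc ⟩
    ε₀ A ∘ ((π₁ ∘ δ₁ A) ∘ ρ⇐)           ≈⟨ pullˡ ε₀∘π₁∘δ₁ ⟩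
    ρ⇒ ∘ ρ⇐                             ≈⟨ ρ-isoʳ ⟩
    id                                  ∎

  π₂∘Δ : ∀ {A} → π₂ ∘ Δ A ≈ id
  π₂∘Δ {A} = begin
    π₂ ∘ ((ε₀ A ⊗₁ ρ′ A) ∘ (δ₁ A ∘ ρ⇐)) ≈⟨ pullˡ π₂-natural ⟩
    (ρ′ A ∘ π₂) ∘ (δ₁ A ∘ ρ⇐)           ≈⟨ pullʳ sym-assoc ⟩
    ρ′ A ∘ ((π₂ ∘ δ₁ A) ∘ ρ⇐)           ≈⟨ pullˡ ρ′∘π₂∘δ₁ ⟩
    ρ⇒ ∘ ρ⇐                             ≈⟨ ρ-isoʳ ⟩
    id                                  ∎

  ε₀-natural : ∀ {A B} (f : A ⇒ B) → ε₀ B ∘ f ≈ f ∘ ε₀ A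
  ε₀-natural f = ε-natural [ f ,id,id,…] 0

  δ₁-natural : ∀ {A B} (f : A ⇒ B) → δ₁ B ∘ (f ⊗₁ id) ≈ (f ⊗₁ (f ⊗₁ id)) ∘ δ₁ A
  δ₁-natural f = δ-natural [ f ,id,id,…] 1

  ρ′-natural : ∀ {A B} (f : A ⇒ B) → ρ′ B ∘ (f ⊗₁ id) ≈ f ∘ ρ′ A
  ρ′-natural {A} {B} f = begin
    (ρ⇒ ∘ (ε-tail B ∘ λ⇐)) ∘ (f ⊗₁ id)               ≈⟨ pullʳ (pullʳ (sym λ⇐-natural)) ⟩
    ρ⇒ ∘ (ε-tail B ∘ ((id ⊗₁ (f ⊗₁ id)) ∘ λ⇐))       ≈⟨ refl⟩∘⟨ pullˡ (ε-natural f-on-tail 1) ⟩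
    ρ⇒ ∘ (((f ⊗₁ id) ∘ ε-tail A) ∘ λ⇐)               ≈⟨ refl⟩∘⟨ assoc ⟩
    ρ⇒ ∘ ((f ⊗₁ id) ∘ (ε-tail A ∘ λ⇐))               ≈⟨ pullˡ ρ-natural ⟩
    (f ∘ ρ⇒) ∘ (ε-tail A ∘ λ⇐)                       ≈⟨ assoc ⟩
    f ∘ ρ′ A                                      ∎
    where
    f-on-tail : ∀ n → withUnitHead (List⁺₀ [ A ,I,I,…]) n ⇒ withUnitHead (List⁺₀ [ B ,I,I,…]) n
    f-on-tail = withUnitHead₁ (List⁺₁ [ f ,id,id,…])

  Δ-natural : ∀ {A B} (f : A ⇒ B) → Δ B ∘ f ≈ (f ⊗₁ f) ∘ Δ A
  Δ-natural {A} {B} f = begin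
    ((ε₀ B ⊗₁ ρ′ B) ∘ (δ₁ B ∘ ρ⇐)) ∘ f                 ≈⟨ pullʳ (pullʳ (sym ρ⇐-natural)) ⟩
    (ε₀ B ⊗₁ ρ′ B) ∘ (δ₁ B ∘ ((f ⊗₁ id) ∘ ρ⇐))         ≈⟨ refl⟩∘⟨ pullˡ (δ₁-natural f) ⟩
    (ε₀ B ⊗₁ ρ′ B) ∘ (((f ⊗₁ (f ⊗₁ id)) ∘ δ₁ A) ∘ ρ⇐)  ≈⟨ refl⟩∘⟨ assoc ⟩
    (ε₀ B ⊗₁ ρ′ B) ∘ ((f ⊗₁ (f ⊗₁ id)) ∘ (δ₁ A ∘ ρ⇐))  ≈⟨ pullˡ ⊗∘⊗ ⟩
    ((ε₀ B ∘ f) ⊗₁ (ρ′ B ∘ (f ⊗₁ id))) ∘ (δ₁ A ∘ ρ⇐)   ≈⟨ (ε₀-natural f ⟩⊗⟨ ρ′-natural f) ⟩∘⟨refl ⟩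
    ((f ∘ ε₀ A) ⊗₁ (f ∘ ρ′ A)) ∘ (δ₁ A ∘ ρ⇐)           ≈⟨ pushˡ ⊗-homomorphism ⟩
    (f ⊗₁ f) ∘ Δ A                                     ∎

  π₁⊗π₂⊗id∘δ₁ : ∀ {A B} → (π₁ ⊗₁ (π₂ ⊗₁ id)) ∘ δ₁ (A ⊗₀ B)
                          ≈ ((π₁ ∘ δ₁ A) ⊗₁ (π₂ ∘ δ₁ B)) ∘ (interchange ∘ (id ⊗₁ λ⇐))
  π₁⊗π₂⊗id∘δ₁ {A} {B} = begin
    (π₁ ⊗₁ (π₂ ⊗₁ id)) ∘ δ₁ (A ⊗₀ B)
      ≈⟨ refl⟩∘⟨ introʳ (id⊗-iso λ-isoʳ) ⟩
    (π₁ ⊗₁ (π₂ ⊗₁ id)) ∘ (δ₁ (A ⊗₀ B) ∘ ((id ⊗₁ λ⇒) ∘ (id ⊗₁ λ⇐)))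
      ≈⟨ refl⟩∘⟨ pullˡ (δ-natural merge 1) ⟩
    (π₁ ⊗₁ (π₂ ⊗₁ id)) ∘ (((id ⊗₁ (id ⊗₁ λ⇒)) ∘ δ S⊗T 1) ∘ (id ⊗₁ λ⇐))
      ≈⟨ pullˡ (pullˡ (trans ⊗∘⊗ (identityʳ ⟩⊗⟨ trans ⊗∘⊗ (identityʳ ⟩⊗⟨ identityˡ)))) ⟩
    ((π₁ ⊗₁ (π₂ ⊗₁ λ⇒)) ∘ δ S⊗T 1) ∘ (id ⊗₁ λ⇐)
      ≈⟨ pushˡ π₁⊗π₂∘ψ₁ ⟩∘⟨refl ⟩
    ((π₁ ⊗₁ π₂) ∘ ((ψ (List⁺₀ S) (List⁺₀ T) 1 ∘ List⁺₁ (ψ S T) 1) ∘ δ S⊗T 1)) ∘ (id ⊗₁ λ⇐)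
      ≈⟨ (refl⟩∘⟨ δ-monoidal-⊗ S T 1) ⟩∘⟨refl ⟩
    ((π₁ ⊗₁ π₂) ∘ ((δ₁ A ⊗₁ δ₁ B) ∘ (interchange ∘ (id ⊗₁ id)))) ∘ (id ⊗₁ λ⇐)
      ≈⟨ pullˡ ⊗∘⊗ ⟩∘⟨refl ⟩
    (((π₁ ∘ δ₁ A) ⊗₁ (π₂ ∘ δ₁ B)) ∘ (interchange ∘ (id ⊗₁ id))) ∘ (id ⊗₁ λ⇐)
      ≈⟨ pullʳ (elimʳ ⊗-identity ⟩∘⟨refl) ⟩
    ((π₁ ∘ δ₁ A) ⊗₁ (π₂ ∘ δ₁ B)) ∘ (interchange ∘ (id ⊗₁ λ⇐)) ∎
    where
    S T S⊗T : ℕ → Obj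
    S   = [ A ,I,I,…]
    T   = [ B ,I,I,…]
    S⊗T = λ m → S m ⊗₀ T m

    merge : ∀ n → S⊗T n ⇒ [ A ⊗₀ B ,I,I,…] n
    merge zero    = id
    merge (suc _) = λ⇒

    π₁⊗π₂∘ψ₁ : π₁ ⊗₁ (π₂ ⊗₁ λ⇒) ≈ (π₁ ⊗₁ π₂) ∘ (ψ (List⁺₀ S) (List⁺₀ T) 1 ∘ List⁺₁ (ψ S T) 1)
    π₁⊗π₂∘ψ₁ = sym (begin
      (π₁ ⊗₁ π₂) ∘ ((interchange ∘ (id ⊗₁ id)) ∘ (id ⊗₁ (interchange ∘ (id ⊗₁ id))))
        ≈⟨ refl⟩∘⟨ elimʳ ⊗-identity ⟩∘⟨ (refl ⟩⊗⟨ elimʳ ⊗-identity) ⟩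
      (π₁ ⊗₁ π₂) ∘ (interchange ∘ (id ⊗₁ interchange)) ≈⟨ pullˡ π₁⊗π₂∘interchange ⟩
      (π₁ ⊗₁ π₂) ∘ (id ⊗₁ interchange)                 ≈⟨ ⊗∘⊗ ⟩
      (π₁ ∘ id) ⊗₁ (π₂ ∘ interchange)                  ≈⟨ identityʳ ⟩⊗⟨ trans π₂∘interchange (refl ⟩⊗⟨ sym λ⇒≈π₂) ⟩
      π₁ ⊗₁ (π₂ ⊗₁ λ⇒)                                 ∎)

  π₁⊗π₂∘Δ : ∀ {A B} → (π₁ ⊗₁ π₂) ∘ Δ (A ⊗₀ B) ≈ id
  π₁⊗π₂∘Δ {A} {B} = begin
    (π₁ ⊗₁ π₂) ∘ ((ε₀ _ ⊗₁ ρ′ _) ∘ (δ₁ _ ∘ ρ⇐))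
      ≈⟨ pullˡ ⊗∘⊗ ⟩
    ((π₁ ∘ ε₀ _) ⊗₁ (π₂ ∘ ρ′ _)) ∘ (δ₁ _ ∘ ρ⇐)
      ≈⟨ (sym (ε₀-natural π₁) ⟩⊗⟨ sym (ρ′-natural π₂)) ⟩∘⟨refl ⟩
    ((ε₀ A ∘ π₁) ⊗₁ (ρ′ B ∘ (π₂ ⊗₁ id))) ∘ (δ₁ _ ∘ ρ⇐)
      ≈⟨ pushˡ ⊗-homomorphism ⟩
    (ε₀ A ⊗₁ ρ′ B) ∘ ((π₁ ⊗₁ (π₂ ⊗₁ id)) ∘ (δ₁ _ ∘ ρ⇐))
      ≈⟨ refl⟩∘⟨ pullˡ π₁⊗π₂⊗id∘δ₁ ⟩
    (ε₀ A ⊗₁ ρ′ B) ∘ ((((π₁ ∘ δ₁ A) ⊗₁ (π₂ ∘ δ₁ B)) ∘ (interchange ∘ (id ⊗₁ λ⇐))) ∘ ρ⇐)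
      ≈⟨ pullˡ (pullˡ ⊗∘⊗) ⟩
    (((ε₀ A ∘ (π₁ ∘ δ₁ A)) ⊗₁ (ρ′ B ∘ (π₂ ∘ δ₁ B))) ∘ (interchange ∘ (id ⊗₁ λ⇐))) ∘ ρ⇐
      ≈⟨ ((ε₀∘π₁∘δ₁ ⟩⊗⟨ ρ′∘π₂∘δ₁) ⟩∘⟨refl) ⟩∘⟨refl ⟩
    ((ρ⇒ ⊗₁ ρ⇒) ∘ (interchange ∘ (id ⊗₁ λ⇐))) ∘ ρ⇐
      ≈⟨ pullˡ ρ⇒⊗ρ⇒∘interchange ⟩∘⟨refl ⟩
    ((ρ⇒ ∘ (id ⊗₁ ρ⇒)) ∘ (id ⊗₁ λ⇐)) ∘ ρ⇐
      ≈⟨ cancelʳ (id⊗-iso ρ⇒∘λ⇐) ⟩∘⟨refl ⟩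
    ρ⇒ ∘ ρ⇐
      ≈⟨ ρ-isoʳ ⟩
    id ∎
    where
    ρ⇒∘λ⇐ : ρ⇒ {unit} ∘ λ⇐ ≈ id
    ρ⇒∘λ⇐ = trans (!-unique₂ ⟩∘⟨refl) λ-isoʳ

  cartesian : IsCartesianMonoidal 𝒞
  cartesian = record
    { !        = !
    ; !-unique = !-unique
    ; ⟨_,_⟩    = λ {Z} f g → (f ⊗₁ g) ∘ Δ Z
    ; project₁ = trans (pullˡ π₁-natural) (trans assoc (elimʳ π₁∘Δ))
    ; project₂ = trans (pullˡ π₂-natural) (trans assoc (elimʳ π₂∘Δ))
    ; unique   = λ {Z} {A} {B} {f} {g} h π₁∘h≈f π₂∘h≈g → begin
        h                              ≈⟨ introˡ π₁⊗π₂∘Δ ⟩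
        ((π₁ ⊗₁ π₂) ∘ Δ (A ⊗₀ B)) ∘ h  ≈⟨ pullʳ (Δ-natural h) ⟩
        (π₁ ⊗₁ π₂) ∘ ((h ⊗₁ h) ∘ Δ Z)  ≈⟨ pullˡ ⊗∘⊗ ⟩
        ((π₁ ∘ h) ⊗₁ (π₂ ∘ h)) ∘ Δ Z   ≈⟨ (π₁∘h≈f ⟩⊗⟨ π₂∘h≈g) ⟩∘⟨refl ⟩
        (f ⊗₁ g) ∘ Δ Z                 ∎
    }

theorem8p6 : ∀ {o ℓ e} (𝒞 : SymmetricMonoidalCategory o ℓ e) →
    List⁺-OplaxMonoidalComonad 𝒞 ⇔ IsCartesianMonoidal 𝒞
theorem8p6 𝒞 = mk⇔ (ComonadCartesian.cartesian 𝒞) (CartesianComonad.List⁺-comonad 𝒞)
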